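{- Let $n\ge 1$ be an integer, let $K_{n,n}$ be the complete bipartite graph with both parts of size $n$, and let $k,d\in\{0,1,2,\dots\}\cup\{\infty\}$. Then $K_{n,n}$ has an equitable $(t,k,d)$-tree-coloring for every even integer $t\ge 2$.
   Context: A $t$-coloring of a graph $G$ is a map $f:V(G)\to\{1,\dots,t\}$ (not necessarily surjective); its color classes are $V_i=\{v: f(v)=i\}$, $1\le i\le t$. It is equitable if $||V_i|-|V_j||\le 1$ for all $i,j$. It is a $(t,k,d)$-tree-coloring if for every $i$, each connected component of the induced subgraph $G[V_i]$ is a tree of maximum degree at most $k$ and diameter at most $d$; the value $\infty$ for $k$ or $d$ means no restriction on that quantity. -}

module Defs where

open import Data.Nat using (ℕ; zero; suc; _+_; _≤_; _<ᵇ_)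
open import Data.Bool using (Bool; true; false; _xor_; _∧_)
open import Data.Fin using (Fin; toℕ; _≟_)
open import Data.List using (List; []; _∷_; length; filterᵇ; allFin; _∷ʳ_)
open import Data.List.Relation.Unary.All using (All)
open import Data.List.Relation.Unary.Unique.Propositional using (Unique)
open import Data.List.Relation.Unary.Linked using (Linked)
open import Data.Product using (Σ; ∃; _×_)
open import Data.Unit using (⊤)
open import Relation.Nullary using (¬_; does)
open import Relation.Binary.PropositionalEquality using (_≡_)

data ℕ∞ : Set where
  fin : ℕ → ℕ∞
  ∞   : ℕ∞

AtMost : ℕ∞ → ℕ → Set
AtMost (fin b) m = m ≤ b
AtMost ∞       m = ⊤

record Graph : Set where
  field
    N   : ℕ
    adj : Fin N → Fin N → Bool
open Graph public

-- K_{n,n}: vertices Fin (n + n); vertices with toℕ v < n form one part,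
-- the others the second part; u ~ v iff they lie in different parts.
K : ℕ → Graph
K n = record { N = n + n ; adj = λ u v → (toℕ u <ᵇ n) xor (toℕ v <ᵇ n) }

module _ (G : Graph) {t : ℕ} (f : Fin (N G) → Fin t) where

  _==_ : ∀ {m} → Fin m → Fin m → Bool
  a == b = does (a ≟ b)

  countV : (Fin (N G) → Bool) → ℕ
  countV p = length (filterᵇ p (allFin (N G)))

  classSize : Fin t → ℕ
  classSize i = countV (λ v → f v == i)

  Equitable : Set
  Equitable = ∀ i j → classSize i ≤ suc (classSize j)

  data Walk (i : Fin t) (u : Fin (N G)) : Fin (N G) → ℕ → Set where
    start : f u ≡ i → Walk i u u 0
    step  : ∀ {v w l} → Walk i u v l → adj G v w ≡ true → f w ≡ i →
            Walk i u w (suc l)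

  -- a cycle in G[V_i]: distinct vertices x, y₁, …, y_m (m ≥ 2, so at least
  -- 3 vertices), all of colour i, with x ~ y₁ ~ … ~ y_m ~ x
  HasCycle : Fin t → Set
  HasCycle i = Σ (Fin (N G)) λ x → Σ (List (Fin (N G))) λ ys →
    (2 ≤ length ys) × Unique (x ∷ ys) × All (λ v → f v ≡ i) (x ∷ ys) ×
    Linked (λ a b → adj G a b ≡ true) ((x ∷ ys) ∷ʳ x)

  degIn : Fin (N G) → ℕ
  degIn v = countV (λ w → adj G v w ∧ (f w == f v))

  -- (t,k,d)-tree-colouring: every component of every G[V_i] is a tree
  -- (i.e. G[V_i] is acyclic), of maximum degree ≤ k and diameter ≤ d.
  TreeColoring : ℕ∞ → ℕ∞ → Set
  TreeColoring k d =
    (∀ i → ¬ HasCycle i) ×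
    (∀ v → AtMost k (degIn v)) ×
    (∀ i u v l → Walk i u v l → ∃ λ l′ → Walk i u v l′ × AtMost d l′)

-- Write t = 2s and colour the i-th vertex of part p ∈ {0, 1} by the pair
-- (i mod s, p). Every colour class lies inside one part, so it is an
-- independent set: a forest of isolated vertices, of degree and diameter 0.
-- The class of (a, p) has as many vertices as there are i < n with
-- i ≡ a (mod s), and these counts are all ⌊n/s⌋ or ⌈n/s⌉.
module Submission where

open import Defs
open import Data.Nat using (ℕ; _≤_; _+_)
open import Data.Nat.Divisibility using (_∣_)
open import Data.Fin using (Fin)
open import Data.Product using (Σ; _×_)

open import Data.Bool using (Bool; true; false; T; if_then_else_; _∧_; _xor_)
open import Data.Bool.Properties using (∧-identityʳ; ∧-zeroʳ; xor-same)
open import Data.Fin using (zero; suc; toℕ; _≟_; _↑ˡ_; _↑ʳ_; splitAt; combine; remQuot)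
open import Data.Fin.Properties
  using (toℕ-↑ˡ; toℕ-↑ʳ; toℕ<n; splitAt-↑ˡ; splitAt-↑ʳ; splitAt⁻¹-↑ˡ; splitAt⁻¹-↑ʳ;
         remQuot-combine; combine-remQuot; combine-injective; fromℕ<-cong; fromℕ<-toℕ)
open import Data.List using (List; []; _∷_; _++_; length; map; filterᵇ; tabulate; allFin)
open import Data.List.Properties using (filter-++; filter-none; filter-≐; length-++; map-tabulate)
open import Data.List.Relation.Unary.All using (universal; _∷_)
open import Data.List.Relation.Unary.Linked using (_∷_)
open import Data.Nat using (zero; suc; NonZero; _<_; _∸_; _*_; _<ᵇ_; z≤n; s≤s)
open import Data.Nat.Properties
  using (+-assoc; +-comm; +-identityʳ; +-monoʳ-≤; m≤m+n; m+[n∸m]≡n; <⇒≤; module ≤-Reasoning)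
open import Data.Nat.DivMod using (_%_; _/_; _mod_; m≡m%n+[m/n]*n; [m+n]%n≡m%n; m<n⇒m%n≡m; m%n<n)
open import Data.Nat.Divisibility using (divides)
open import Data.Product using (_,_; proj₁; proj₂)
open import Data.Sum using (_⊎_; inj₁; inj₂; [_,_]′)
open import Data.Unit using (tt)
open import Function using (_∘_; id; const)
open import Relation.Nullary using (¬_; does; yes; no; contradiction)
open import Relation.Nullary.Decidable using (T?)
open import Relation.Binary.PropositionalEquality

-- countV, and hence classSize and degIn, unfold to count.
count : ∀ {N} → (Fin N → Bool) → ℕ
count {N} p = length (filterᵇ p (allFin N))

count-cong : ∀ {N} {p q : Fin N → Bool} → (∀ i → p i ≡ q i) → count p ≡ count q
count-cong {N} {p} {q} p≗q =
  cong length (filter-≐ (T? ∘ p) (T? ∘ q)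
                        ((λ {i} → subst T (p≗q i)) , (λ {i} → subst T (sym (p≗q i))))
                        (allFin N))

count-false : ∀ N → count {N} (const false) ≡ 0
count-false N = cong length (filter-none (T? ∘ const false) (universal (λ _ ()) (allFin N)))

length-filterᵇ-map : ∀ {A B : Set} (p : B → Bool) (g : A → B) (xs : List A) →
                     length (filterᵇ p (map g xs)) ≡ length (filterᵇ (p ∘ g) xs)
length-filterᵇ-map p g []       = refl
length-filterᵇ-map p g (x ∷ xs) with p (g x)
... | true  = cong suc (length-filterᵇ-map p g xs)
... | false = length-filterᵇ-map p g xs

tabulate-+ : ∀ {A : Set} m {n} (g : Fin (m + n) → A) →
             tabulate g ≡ tabulate (g ∘ (_↑ˡ n)) ++ tabulate (g ∘ (m ↑ʳ_))
tabulate-+ zero    g = refl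
tabulate-+ (suc m) g = cong (g zero ∷_) (tabulate-+ m (g ∘ suc))

count-tabulate : ∀ {M N} (p : Fin M → Bool) (g : Fin N → Fin M) →
                 length (filterᵇ p (tabulate g)) ≡ count (p ∘ g)
count-tabulate {N = N} p g = trans (cong (length ∘ filterᵇ p) (sym (map-tabulate id g)))
                                   (length-filterᵇ-map p g (allFin N))

count-+ : ∀ m {n} (p : Fin (m + n) → Bool) →
          count p ≡ count (p ∘ (_↑ˡ n)) + count (p ∘ (m ↑ʳ_))
count-+ m {n} p = begin
  length (filterᵇ p (allFin (m + n)))
    ≡⟨ cong (length ∘ filterᵇ p) (tabulate-+ m id) ⟩
  length (filterᵇ p (tabulate (_↑ˡ n) ++ tabulate (m ↑ʳ_)))
    ≡⟨ cong length (filter-++ (T? ∘ p) (tabulate (_↑ˡ n)) (tabulate (m ↑ʳ_))) ⟩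
  length (filterᵇ p (tabulate (_↑ˡ n)) ++ filterᵇ p (tabulate (m ↑ʳ_)))
    ≡⟨ length-++ (filterᵇ p (tabulate (_↑ˡ n))) ⟩
  length (filterᵇ p (tabulate (_↑ˡ n))) + length (filterᵇ p (tabulate (m ↑ʳ_)))
    ≡⟨ cong₂ _+_ (count-tabulate p (_↑ˡ n)) (count-tabulate p (m ↑ʳ_)) ⟩
  count (p ∘ (_↑ˡ n)) + count (p ∘ (m ↑ʳ_)) ∎
  where open ≡-Reasoning

count-≟ : ∀ {N} (i : Fin N) → count (λ j → does (j ≟ i)) ≡ 1
count-≟ {suc N} zero    = trans (count-+ 1 {N} (λ j → does (j ≟ zero))) (cong suc (count-false N))
count-≟ {suc N} (suc i) = trans (count-+ 1 {N} (λ j → does (j ≟ suc i))) (count-≟ i)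

count-∧ʳ : ∀ {N} (p : Fin N → Bool) b → count (λ i → p i ∧ b) ≡ (if b then count p else 0)
count-∧ʳ     p true  = count-cong (λ i → ∧-identityʳ (p i))
count-∧ʳ {N} p false = trans (count-cong (λ i → ∧-zeroʳ (p i))) (count-false N)

countBelow : ℕ → (ℕ → Bool) → ℕ
countBelow N q = count {N} (q ∘ toℕ)

countBelow-+ : ∀ m n (q : ℕ → Bool) →
               countBelow (m + n) q ≡ countBelow m q + countBelow n (q ∘ (m +_))
countBelow-+ m n q = trans (count-+ m {n} (q ∘ toℕ))
  (cong₂ _+_ (count-cong {m} (λ i → cong q (toℕ-↑ˡ i n)))
             (count-cong {n} (λ i → cong q (toℕ-↑ʳ m i))))

countBelow-mono : ∀ {m N} (q : ℕ → Bool) → m ≤ N → countBelow m q ≤ countBelow N q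
countBelow-mono {m} {N} q m≤N = begin
  countBelow m q                                              ≤⟨ m≤m+n _ _ ⟩
  countBelow m q + countBelow (N ∸ m) (q ∘ (m +_))            ≡⟨ countBelow-+ m (N ∸ m) q ⟨
  countBelow (m + (N ∸ m)) q                                  ≡⟨ cong (λ M → countBelow M q) (m+[n∸m]≡n m≤N) ⟩
  countBelow N q                                              ∎
  where open ≤-Reasoning

module Residues (s : ℕ) .{{_ : NonZero s}} where

  residueCount : ℕ → Fin s → ℕ
  residueCount N a = countBelow N (λ m → does (m mod s ≟ a))

  toℕ-mod : ∀ (a : Fin s) → toℕ a mod s ≡ a
  toℕ-mod a = trans (fromℕ<-cong _ _ (m<n⇒m%n≡m (toℕ<n a)) (m%n<n (toℕ a) s) (toℕ<n a))
                    (fromℕ<-toℕ a (toℕ<n a))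

  +-mod : ∀ m → (s + m) mod s ≡ m mod s
  +-mod m = fromℕ<-cong _ _ (trans (cong (_% s) (+-comm s m)) ([m+n]%n≡m%n m s))
                        (m%n<n (s + m) s) (m%n<n m s)

  residueCount-period : ∀ a → residueCount s a ≡ 1
  residueCount-period a = trans (count-cong (λ i → cong (λ x → does (x ≟ a)) (toℕ-mod i)))
                                (count-≟ a)

  residueCount-+period : ∀ N a → residueCount (s + N) a ≡ suc (residueCount N a)
  residueCount-+period N a = trans (countBelow-+ s N (λ m → does (m mod s ≟ a)))
    (cong₂ _+_ (residueCount-period a)
               (count-cong {N} (λ i → cong (λ x → does (x ≟ a)) (+-mod (toℕ i)))))

  residueCount-*period : ∀ q r a → residueCount (q * s + r) a ≡ q + residueCount r a
  residueCount-*period zero    r a = refl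
  residueCount-*period (suc q) r a =
    trans (cong (λ M → residueCount M a) (+-assoc s (q * s) r))
          (trans (residueCount-+period (q * s + r) a) (cong suc (residueCount-*period q r a)))

  residueCount-≤1 : ∀ {r} a → r < s → residueCount r a ≤ 1
  residueCount-≤1 {r} a r<s =
    subst (residueCount r a ≤_) (residueCount-period a)
          (countBelow-mono (λ m → does (m mod s ≟ a)) (<⇒≤ r<s))

  residueCount-balanced : ∀ N a b → residueCount N a ≤ suc (residueCount N b)
  residueCount-balanced N a b = begin
    residueCount N a                 ≡⟨ cong (λ M → residueCount M a) N≡qs+r ⟩
    residueCount (q * s + r) a       ≡⟨ residueCount-*period q r a ⟩
    q + residueCount r a             ≤⟨ +-monoʳ-≤ q (residueCount-≤1 a (m%n<n N s)) ⟩
    q + 1                            ≡⟨ +-comm q 1 ⟩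
    suc q                            ≤⟨ s≤s (m≤m+n q _) ⟩
    suc (q + residueCount r b)       ≡⟨ cong suc (residueCount-*period q r b) ⟨
    suc (residueCount (q * s + r) b) ≡⟨ cong (λ M → suc (residueCount M b)) N≡qs+r ⟨
    suc (residueCount N b)           ∎
    where
    open ≤-Reasoning
    q r : ℕ
    q = N / s
    r = N % s
    N≡qs+r : N ≡ q * s + r
    N≡qs+r = trans (m≡m%n+[m/n]*n N s) (+-comm r (q * s))

ProperColoring : (G : Graph) {t : ℕ} → (Fin (N G) → Fin t) → Set
ProperColoring G f = ∀ u v → f u ≡ f v → adj G u v ≡ false

AtMost-0 : ∀ b → AtMost b 0
AtMost-0 (fin b) = z≤n
AtMost-0 ∞       = tt

module _ (G : Graph) {t : ℕ} {f : Fin (N G) → Fin t} (proper : ProperColoring G f) where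

  no-edge : ∀ {i u v} → f u ≡ i → f v ≡ i → adj G u v ≢ true
  no-edge fu≡i fv≡i uv = contradiction (trans (sym uv) (proper _ _ (trans fu≡i (sym fv≡i)))) λ ()

  walk-end-colour : ∀ {i u v l} → Walk G f i u v l → f v ≡ i
  walk-end-colour (start fu≡i)    = fu≡i
  walk-end-colour (step _ _ fw≡i) = fw≡i

  walk-length-0 : ∀ {i u v l} → Walk G f i u v l → l ≡ 0
  walk-length-0 (start _)          = refl
  walk-length-0 (step w vw fw≡i) = contradiction vw (no-edge (walk-end-colour w) fw≡i)

  proper-acyclic : ∀ i → ¬ HasCycle G f i
  proper-acyclic i (x , y ∷ _ , _ , _ , fx≡i ∷ fy≡i ∷ _ , xy ∷ _) = no-edge fx≡i fy≡i xy

  proper-degIn : ∀ v → degIn G f v ≡ 0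
  proper-degIn v = trans (count-cong edge-same-colour) (count-false (N G))
    where
    edge-same-colour : ∀ w → (adj G v w ∧ does (f w ≟ f v)) ≡ false
    edge-same-colour w with f w ≟ f v
    ... | yes fw≡fv = trans (∧-identityʳ _) (proper v w (sym fw≡fv))
    ... | no  _     = ∧-zeroʳ _

  proper⇒treeColoring : ∀ k d → TreeColoring G f k d
  proper⇒treeColoring k d =
    proper-acyclic ,
    (λ v → subst (AtMost k) (sym (proper-degIn v)) (AtMost-0 k)) ,
    (λ i u v l w → l , w , subst (AtMost d) (sym (walk-length-0 w)) (AtMost-0 d))

K-proper : ∀ {n t} {f : Fin (n + n) → Fin t} (firstPart : Fin t → Bool) →
           (∀ v → firstPart (f v) ≡ (toℕ v <ᵇ n)) → ProperColoring (K n) f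
K-proper {n} {f = f} firstPart readable u v fu≡fv = begin
  (toℕ u <ᵇ n) xor (toℕ v <ᵇ n)          ≡⟨ cong₂ _xor_ (readable u) (readable v) ⟨
  firstPart (f u) xor firstPart (f v)    ≡⟨ cong (λ c → firstPart c xor firstPart (f v)) fu≡fv ⟩
  firstPart (f v) xor firstPart (f v)    ≡⟨ xor-same (firstPart (f v)) ⟩
  false                                  ∎
  where open ≡-Reasoning

toℕ<ᵇ : ∀ {n} (i : Fin n) → (toℕ i <ᵇ n) ≡ true
toℕ<ᵇ zero    = refl
toℕ<ᵇ (suc i) = toℕ<ᵇ i

+-≮ᵇ : ∀ m k → (m + k <ᵇ m) ≡ false
+-≮ᵇ zero    k = refl
+-≮ᵇ (suc m) k = +-≮ᵇ m k

combine-≟ : ∀ {m n} (a c : Fin m) (b d : Fin n) →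
            does (combine a b ≟ combine c d) ≡ does (a ≟ c) ∧ does (b ≟ d)
combine-≟ a c b d with combine a b ≟ combine c d | a ≟ c | b ≟ d
... | yes _     | yes _    | yes _    = refl
... | yes ab≡cd | no a≢c   | _        = contradiction (proj₁ (combine-injective a b c d ab≡cd)) a≢c
... | yes ab≡cd | yes _    | no b≢d   = contradiction (proj₂ (combine-injective a b c d ab≡cd)) b≢d
... | no ab≢cd  | yes refl | yes refl = contradiction refl ab≢cd
... | no _      | yes _    | no _     = refl
... | no _      | no _     | _        = refl

module KColoring (n s : ℕ) .{{_ : NonZero s}} where
  open Residues s

  colour : Fin 2 → Fin n → Fin (s * 2)
  colour part i = combine (toℕ i mod s) part

  colouring : Fin (n + n) → Fin (s * 2)
  colouring v = [ colour zero , colour (suc zero) ]′ (splitAt n v)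

  inFirstPart : Fin (s * 2) → Bool
  inFirstPart c = does (proj₂ (remQuot {s} 2 c) ≟ zero)

  inFirstPart-colour : ∀ part i → inFirstPart (colour part i) ≡ does (part ≟ zero)
  inFirstPart-colour part i = cong (λ x → does (proj₂ x ≟ zero)) (remQuot-combine (toℕ i mod s) part)

  colouring-inFirstPart : ∀ v → inFirstPart (colouring v) ≡ (toℕ v <ᵇ n)
  colouring-inFirstPart v with splitAt n v in eq
  ... | inj₁ i = begin
    inFirstPart (colour zero i) ≡⟨ inFirstPart-colour zero i ⟩
    true                        ≡⟨ toℕ<ᵇ i ⟨
    toℕ i <ᵇ n                  ≡⟨ cong (_<ᵇ n) (toℕ-↑ˡ i n) ⟨
    toℕ (i ↑ˡ n) <ᵇ n           ≡⟨ cong (λ w → toℕ w <ᵇ n) (splitAt⁻¹-↑ˡ eq) ⟩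
    toℕ v <ᵇ n                  ∎
    where open ≡-Reasoning
  ... | inj₂ i = begin
    inFirstPart (colour (suc zero) i) ≡⟨ inFirstPart-colour (suc zero) i ⟩
    false                             ≡⟨ +-≮ᵇ n (toℕ i) ⟨
    n + toℕ i <ᵇ n                    ≡⟨ cong (_<ᵇ n) (toℕ-↑ʳ n i) ⟨
    toℕ (n ↑ʳ i) <ᵇ n                 ≡⟨ cong (λ w → toℕ w <ᵇ n) (splitAt⁻¹-↑ʳ eq) ⟩
    toℕ v <ᵇ n                        ∎
    where open ≡-Reasoning

  colouring-proper : ProperColoring (K n) colouring
  colouring-proper = K-proper {n} inFirstPart colouring-inFirstPart

  count-colour : ∀ part a part′ → count (λ i → does (colour part i ≟ combine a part′)) ≡
                                   (if does (part ≟ part′) then residueCount n a else 0)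
  count-colour part a part′ =
    trans (count-cong {n} (λ i → combine-≟ (toℕ i mod s) a part part′))
          (count-∧ʳ {n} (λ i → does (toℕ i mod s ≟ a)) (does (part ≟ part′)))

  classSize-combine : ∀ a part → classSize (K n) colouring (combine a part) ≡ residueCount n a
  classSize-combine a part = begin
    classSize (K n) colouring c
      ≡⟨ count-+ n {n} (λ v → does (colouring v ≟ c)) ⟩
    count (λ i → does (colouring (i ↑ˡ n) ≟ c)) + count (λ i → does (colouring (n ↑ʳ i) ≟ c))
      ≡⟨ cong₂ _+_ (count-cong {n} (λ i → cong (λ w → does (colour′ w ≟ c)) (splitAt-↑ˡ n i n)))
                   (count-cong {n} (λ i → cong (λ w → does (colour′ w ≟ c)) (splitAt-↑ʳ n n i))) ⟩
    count (λ i → does (colour zero i ≟ c)) + count (λ i → does (colour (suc zero) i ≟ c))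
      ≡⟨ cong₂ _+_ (count-colour zero a part) (count-colour (suc zero) a part) ⟩
    (if does (zero ≟ part) then residueCount n a else 0) +
    (if does (suc zero ≟ part) then residueCount n a else 0)
      ≡⟨ exactly-one-part part ⟩
    residueCount n a ∎
    where
    open ≡-Reasoning
    c : Fin (s * 2)
    c = combine a part
    colour′ : Fin n ⊎ Fin n → Fin (s * 2)
    colour′ = [ colour zero , colour (suc zero) ]′
    exactly-one-part : ∀ part → (if does (zero ≟ part) then residueCount n a else 0) +
                                (if does (suc zero ≟ part) then residueCount n a else 0) ≡ residueCount n a
    exactly-one-part zero       = +-identityʳ (residueCount n a)
    exactly-one-part (suc zero) = refl

  classSize-residue : ∀ c → classSize (K n) colouring c ≡ residueCount n (proj₁ (remQuot {s} 2 c))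
  classSize-residue c = subst (λ x → classSize (K n) colouring x ≡ residueCount n (proj₁ (remQuot {s} 2 c)))
                              (combine-remQuot {s} 2 c) (classSize-combine _ _)

  colouring-equitable : Equitable (K n) colouring
  colouring-equitable c c′ =
    subst₂ (λ x y → x ≤ suc y) (sym (classSize-residue c)) (sym (classSize-residue c′))
           (residueCount-balanced n _ _)

lemma2p1 : (n : ℕ) → 1 ≤ n → (k d : ℕ∞) → (t : ℕ) → 2 ∣ t → 2 ≤ t →
    Σ (Fin (n + n) → Fin t) λ f → Equitable (K n) f × TreeColoring (K n) f k d
lemma2p1 n _ k d .(zero * 2)  (divides zero refl)    ()
lemma2p1 n _ k d .(suc s * 2) (divides (suc s) refl) _ =
  colouring , colouring-equitable , proper⇒treeColoring (K n) colouring-proper k d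
  where open KColoring n (suc s)
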